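{- The order-preserving logic $\vdash^{\leq}_{\mathbb{DN}}$ of the variety $\mathbb{DN}$ of distributive lattices with negation is not finitely based.
   Context: Fix the language with binary connectives $\land,\lor$, unary $\neg$ and constants $\bot,\top$; $Fm$ is the set of formulas built from a countably infinite set of propositional variables. A distributive lattice with negation is an algebra $\langle A;\land,\lor,\neg,\bot,\top\rangle$ whose reduct $\langle A;\land,\lor,\bot,\top\rangle$ is a bounded distributive lattice and which satisfies $\neg\bot\approx\top$ and $\neg(x\lor y)\approx\neg x\land\neg y$; $\mathbb{DN}$ is the variety of all such algebras. For a class $\mathbb{K}\subseteq\mathbb{DN}$, the order-preserving logic $\vdash^{\leq}_{\mathbb{K}}$ is the consequence relation on $Fm$ given by: $\Gamma\vdash^{\leq}_{\mathbb{K}}\varphi$ iff for every $\mathbf{A}\in\mathbb{K}$, every non-empty lattice filter $F$ of $\mathbf{A}$ and every homomorphism $h\colon Fm\to A$, $h[\Gamma]\subseteq F$ implies $h(\varphi)\in F$ (equivalently: $\emptyset\vdash\varphi$ iff $\mathbb{K}\models\varphi\approx\top$, and for $\Gamma\neq\emptyset$, $\Gamma\vdash\varphi$ iff $\mathbb{K}\models \gamma_1\land\dots\land\gamma_n\le\varphi$ for some $\gamma_1,\dots,\gamma_n\in\Gamma$). A Hilbert rule schema is a pair $\frac{\Gamma}{\varphi}$ with $\Gamma$ a finite (possibly empty) set of formulas; a set $\mathcal{R}$ of rule schemata determines the logic $\vdash_{\mathcal{R}}$ of Hilbert derivations using substitution instances of the rules. A logic is finitely based if it equals $\vdash_{\mathcal{R}}$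 for some finite set $\mathcal{R}$ of rule schemata. -}

module Defs where

open import Data.Nat using (ℕ)
open import Data.Product using (Σ; _×_; ∃)
open import Data.List using (List)
open import Data.List.Membership.Propositional using (_∈_)
open import Relation.Binary.PropositionalEquality using (_≡_)
import Algebra.Definitions as AD
import Algebra.Lattice.Structures as LS

infixr 6 _∧'_
infixr 5 _∨'_

data Fm : Set where
  var  : ℕ → Fm
  _∧'_ : Fm → Fm → Fm
  _∨'_ : Fm → Fm → Fm
  ¬'_  : Fm → Fm
  ⊥'   : Fm
  ⊤'   : Fm

record DNAlgebra : Set₁ where
  field
    Carrier : Set
    _∧_ _∨_ : Carrier → Carrier → Carrier
    ¬_      : Carrier → Carrier
    ⊥ ⊤     : Carrier
    isDistributiveLattice : LS.IsDistributiveLattice {A = Carrier} _≡_ _∨_ _∧_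
    ∧-identity : AD.Identity {A = Carrier} _≡_ ⊤ _∧_
    ∨-identity : AD.Identity {A = Carrier} _≡_ ⊥ _∨_
    ¬⊥≈⊤  : ¬ ⊥ ≡ ⊤
    ¬-∨   : ∀ x y → ¬ (x ∨ y) ≡ (¬ x) ∧ (¬ y)

  _≤_ : Carrier → Carrier → Set
  x ≤ y = x ∧ y ≡ x

module _ (𝔸 : DNAlgebra) where
  open DNAlgebra 𝔸

  ⟦_⟧ : Fm → (ℕ → Carrier) → Carrier
  ⟦ var n ⟧ v = v n
  ⟦ φ ∧' ψ ⟧ v = ⟦ φ ⟧ v ∧ ⟦ ψ ⟧ v
  ⟦ φ ∨' ψ ⟧ v = ⟦ φ ⟧ v ∨ ⟦ ψ ⟧ v
  ⟦ ¬' φ ⟧ v = ¬ (⟦ φ ⟧ v)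
  ⟦ ⊥' ⟧ v = ⊥
  ⟦ ⊤' ⟧ v = ⊤

  record IsFilter (F : Carrier → Set) : Set where
    field
      nonEmpty : ∃ F
      upClosed : ∀ {x y} → x ≤ y → F x → F y
      ∧-closed : ∀ {x y} → F x → F y → F (x ∧ y)

FmSet : Set₁
FmSet = Fm → Set

_⊢≤DN_ : FmSet → Fm → Set₁
Γ ⊢≤DN φ = (𝔸 : DNAlgebra) (F : DNAlgebra.Carrier 𝔸 → Set) → IsFilter 𝔸 F →
           (v : ℕ → DNAlgebra.Carrier 𝔸) →
           (∀ γ → Γ γ → F (⟦ 𝔸 ⟧ γ v)) → F (⟦ 𝔸 ⟧ φ v)

_[_] : Fm → (ℕ → Fm) → Fm
var n [ σ ] = σ n
(φ ∧' ψ) [ σ ] = (φ [ σ ]) ∧' (ψ [ σ ])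
(φ ∨' ψ) [ σ ] = (φ [ σ ]) ∨' (ψ [ σ ])
(¬' φ) [ σ ] = ¬' (φ [ σ ])
⊥' [ σ ] = ⊥'
⊤' [ σ ] = ⊤'

record Rule : Set where
  constructor _/_
  field
    premises   : List Fm
    conclusion : Fm
open Rule public

data _⊢[_]_ (Γ : FmSet) (ℛ : List Rule) : Fm → Set where
  assumption : ∀ {φ} → Γ φ → Γ ⊢[ ℛ ] φ
  apply      : ∀ {r} → r ∈ ℛ → (σ : ℕ → Fm) →
               (∀ ψ → ψ ∈ premises r → Γ ⊢[ ℛ ] (ψ [ σ ])) →
               Γ ⊢[ ℛ ] (conclusion r [ σ ])

Axiomatizes : List Rule → Set₁
Axiomatizes ℛ = ∀ (Γ : FmSet) (φ : Fm) → (Γ ⊢[ ℛ ] φ → Γ ⊢≤DN φ) × (Γ ⊢≤DN φ → Γ ⊢[ ℛ ] φ)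

FinitelyBased : Set₁
FinitelyBased = Σ (List Rule) Axiomatizes

-- A finite set ℛ of rules only mentions formulas of ¬-depth at most some d. Put k = d + 1 and
-- evaluate formulas in Boolean streams, where ¬ negates the next entry and ∧ is complemented at
-- entry k. On formulas of depth ≤ d, entry 0 of this twisted evaluation coincides with entry 0 of
-- the evaluation in the 𝔻ℕ-algebra Boolᵏ with (¬x)ᵢ = ¬xᵢ₊₁; as each rule of ℛ is sound for the
-- filter {x ∣ x₀ = true} there, ℛ-derivations preserve truth at entry 0 of twisted streams. The
-- valid consequence ¬ᵏ(p ∧ p) ⊢ ¬ᵏp is not preserved: the complemented meet at entry k makes its
-- premise true and its conclusion false.

module Submission where

open import Defs
open import Level using (0ℓ)
open import Relation.Nullary using (¬_)
open import Relation.Nullary.Decidable using (does; dec-true; dec-false)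
open import Relation.Binary.PropositionalEquality
  using (_≡_; refl; sym; trans; cong; cong₂; subst; isEquivalence; module ≡-Reasoning)
open import Algebra.Core using (Op₂)
open import Algebra.Lattice.Bundles using (Lattice)
open import Algebra.Lattice.Structures using (IsDistributiveLattice)
import Algebra.Lattice.Properties.Lattice as LatticeProperties
import Algebra.Lattice.Properties.BooleanAlgebra as BooleanAlgebraProperties
open import Data.Bool using (Bool; true; false; not; _∧_; _∨_; if_then_else_)
open import Data.Bool.Properties
  using ( ∨-∧-isDistributiveLattice; ∨-∧-booleanAlgebra; ∧-identity; ∨-identity; ∧-conicalʳ; ∧-idem
        ; not-involutive; not-¬)
open import Data.Nat using (ℕ; zero; suc; _+_; _⊔_; _≤_; _<_; s≤s; _≟_)
open import Data.Nat.Properties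
  using (≤-<-trans; +-monoʳ-≤; m≤m⊔n; m≤n⊔m; m+n≤o⇒m≤o; +-suc; +-identityʳ; <⇒≢)
open import Data.Nat.GeneralisedArithmetic using (iterate)
open import Data.Product using (∃; _×_; _,_; proj₁; proj₂)
open import Data.List using (List; _∷_; map; concatMap)
open import Data.List.Extrema.Nat using (max; xs≤max)
open import Data.List.Membership.Propositional using (_∈_)
open import Data.List.Relation.Unary.All as All using (All; _∷_)
open import Data.List.Relation.Unary.All.Properties using (map⁻; concat⁻)
open import Data.Vec using (Vec; []; _∷_; zipWith; replicate)
open import Data.Vec.Relation.Binary.Pointwise.Inductive as Pointwise using (Pointwise-≡⇒≡)

module _ {A : Set} {_⊕_ _⊗_ : Op₂ A} (isDL : IsDistributiveLattice _≡_ _⊕_ _⊗_) where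
  open IsDistributiveLattice isDL
    using (∨-comm; ∨-assoc; ∧-comm; ∧-assoc; ∨-absorbs-∧; ∧-absorbs-∨;
           ∨-distribˡ-∧; ∨-distribʳ-∧; ∧-distribˡ-∨; ∧-distribʳ-∨)

  zipWith-isDistributiveLattice : ∀ {n} → IsDistributiveLattice _≡_ (zipWith {n = n} _⊕_) (zipWith _⊗_)
  zipWith-isDistributiveLattice = record
    { isLattice = record
      { isEquivalence = isEquivalence
      ; ∨-comm = λ xs ys → Pointwise-≡⇒≡ (Pointwise.zipWith-comm ∨-comm xs ys)
      ; ∨-assoc = λ xs ys zs → Pointwise-≡⇒≡ (Pointwise.zipWith-assoc ∨-assoc xs ys zs)
      ; ∨-cong = cong₂ _
      ; ∧-comm = λ xs ys → Pointwise-≡⇒≡ (Pointwise.zipWith-comm ∧-comm xs ys)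
      ; ∧-assoc = λ xs ys zs → Pointwise-≡⇒≡ (Pointwise.zipWith-assoc ∧-assoc xs ys zs)
      ; ∧-cong = cong₂ _
      ; absorptive = zipWith-absorbs ∨-absorbs-∧ , zipWith-absorbs ∧-absorbs-∨
      }
    ; ∨-distrib-∧ = zipWith-distribˡ ∨-distribˡ-∧ , zipWith-distribʳ ∨-distribʳ-∧
    ; ∧-distrib-∨ = zipWith-distribˡ ∧-distribˡ-∨ , zipWith-distribʳ ∧-distribʳ-∨
    }
    where
    zipWith-absorbs : ∀ {f g : Op₂ A} → (∀ a b → f a (g a b) ≡ a) →
                      ∀ {n} (xs ys : Vec A n) → zipWith f xs (zipWith g xs ys) ≡ xs
    zipWith-absorbs abs [] [] = refl
    zipWith-absorbs abs (x ∷ xs) (y ∷ ys) = cong₂ _∷_ (abs x y) (zipWith-absorbs abs xs ys)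

    zipWith-distribˡ : ∀ {f g : Op₂ A} → (∀ a b c → f a (g b c) ≡ g (f a b) (f a c)) →
                       ∀ {n} (xs ys zs : Vec A n) →
                       zipWith f xs (zipWith g ys zs) ≡ zipWith g (zipWith f xs ys) (zipWith f xs zs)
    zipWith-distribˡ dist [] [] [] = refl
    zipWith-distribˡ dist (x ∷ xs) (y ∷ ys) (z ∷ zs) = cong₂ _∷_ (dist x y z) (zipWith-distribˡ dist xs ys zs)

    zipWith-distribʳ : ∀ {f g : Op₂ A} → (∀ a b c → f (g b c) a ≡ g (f b a) (f c a)) →
                       ∀ {n} (xs ys zs : Vec A n) →
                       zipWith f (zipWith g ys zs) xs ≡ zipWith g (zipWith f ys xs) (zipWith f zs xs)
    zipWith-distribʳ dist [] [] [] = refl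
    zipWith-distribʳ dist (x ∷ xs) (y ∷ ys) (z ∷ zs) = cong₂ _∷_ (dist x y z) (zipWith-distribʳ dist xs ys zs)

zipWith-identity : ∀ {A : Set} {e : A} {f : Op₂ A} {n} →
                   (∀ a → f e a ≡ a) × (∀ a → f a e ≡ a) →
                   (∀ xs → zipWith f (replicate n e) xs ≡ xs) × (∀ xs → zipWith f xs (replicate n e) ≡ xs)
zipWith-identity (idˡ , idʳ) =
  (λ xs → Pointwise-≡⇒≡ (Pointwise.zipWith-identityˡ idˡ xs)) ,
  (λ xs → Pointwise-≡⇒≡ (Pointwise.zipWith-identityʳ idʳ xs))

infixl 9 _!_

-- Past its end a vector reads false, which makes the last entry of shiftNot bs true.
_!_ : ∀ {n} → Vec Bool n → ℕ → Bool
[] ! _ = false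
(b ∷ _) ! zero = b
(_ ∷ bs) ! suc i = bs ! i

!-zipWith : ∀ {f : Op₂ Bool} {n} → f false false ≡ false →
            ∀ (xs ys : Vec Bool n) i → zipWith f xs ys ! i ≡ f (xs ! i) (ys ! i)
!-zipWith f00 [] [] i = sym f00
!-zipWith f00 (x ∷ xs) (y ∷ ys) zero = refl
!-zipWith f00 (x ∷ xs) (y ∷ ys) (suc i) = !-zipWith f00 xs ys i

!-replicate : ∀ {n i} b → i < n → replicate n b ! i ≡ b
!-replicate {i = zero} b (s≤s _) = refl
!-replicate {i = suc i} b (s≤s i<n) = !-replicate b i<n

shiftNot : ∀ {n} → Vec Bool n → Vec Bool n
shiftNot [] = []
shiftNot (_ ∷ bs) = not (bs ! 0) ∷ shiftNot bs

!-shiftNot : ∀ {n i} (bs : Vec Bool n) → i < n → shiftNot bs ! i ≡ not (bs ! suc i)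
!-shiftNot {i = zero} (_ ∷ _) _ = refl
!-shiftNot {i = suc i} (_ ∷ bs) (s≤s i<n) = !-shiftNot bs i<n

prefix : ∀ n → (ℕ → Bool) → Vec Bool n
prefix zero f = []
prefix (suc n) f = f 0 ∷ prefix n (λ i → f (suc i))

!-prefix : ∀ {n i} f → i < n → prefix n f ! i ≡ f i
!-prefix {i = zero} f (s≤s _) = refl
!-prefix {i = suc i} f (s≤s i<n) = !-prefix (λ j → f (suc j)) i<n

shiftNot-⊥ : ∀ n → shiftNot (replicate n false) ≡ replicate n true
shiftNot-⊥ zero = refl
shiftNot-⊥ (suc zero) = refl
shiftNot-⊥ (suc (suc n)) = cong (true ∷_) (shiftNot-⊥ (suc n))

shiftNot-∨ : ∀ {n} (xs ys : Vec Bool n) → shiftNot (zipWith _∨_ xs ys) ≡ zipWith _∧_ (shiftNot xs) (shiftNot ys)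
shiftNot-∨ [] [] = refl
shiftNot-∨ (_ ∷ xs) (_ ∷ ys) = cong₂ _∷_ not-∨ (shiftNot-∨ xs ys)
  where
  open BooleanAlgebraProperties ∨-∧-booleanAlgebra using (deMorgan₂)
  not-∨ : not (zipWith _∨_ xs ys ! 0) ≡ not (xs ! 0) ∧ not (ys ! 0)
  not-∨ = trans (cong not (!-zipWith refl xs ys 0)) (deMorgan₂ (xs ! 0) (ys ! 0))

ShiftAlgebra : ℕ → DNAlgebra
ShiftAlgebra n = record
  { Carrier = Vec Bool n
  ; _∧_ = zipWith _∧_
  ; _∨_ = zipWith _∨_
  ; ¬_ = shiftNot
  ; ⊥ = replicate n false
  ; ⊤ = replicate n true
  ; isDistributiveLattice = zipWith-isDistributiveLattice ∨-∧-isDistributiveLattice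
  ; ∧-identity = zipWith-identity ∧-identity
  ; ∨-identity = zipWith-identity ∨-identity
  ; ¬⊥≈⊤ = shiftNot-⊥ n
  ; ¬-∨ = shiftNot-∨
  }

HeadTrue : ∀ {n} → Vec Bool (suc n) → Set
HeadTrue bs = bs ! 0 ≡ true

headTrue-isFilter : ∀ n → IsFilter (ShiftAlgebra (suc n)) HeadTrue
headTrue-isFilter n = record
  { nonEmpty = replicate (suc n) true , refl
  ; upClosed = λ {xs} {ys} xs∧ys≡xs xs₀ →
      ∧-conicalʳ (xs ! 0) (ys ! 0)
        (trans (sym (!-zipWith refl xs ys 0)) (trans (cong (_! 0) xs∧ys≡xs) xs₀))
  ; ∧-closed = λ {xs} {ys} xs₀ ys₀ → trans (!-zipWith refl xs ys 0) (cong₂ _∧_ xs₀ ys₀)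
  }

DNAlgebra-lattice : DNAlgebra → Lattice 0ℓ 0ℓ
DNAlgebra-lattice 𝔸 = record { isLattice = IsDistributiveLattice.isLattice (DNAlgebra.isDistributiveLattice 𝔸) }

⟦iterate¬⟧ : ∀ 𝔸 χ m v → ⟦ 𝔸 ⟧ (iterate ¬'_ χ m) v ≡ iterate (DNAlgebra.¬_ 𝔸) (⟦ 𝔸 ⟧ χ v) m
⟦iterate¬⟧ 𝔸 χ zero v = refl
⟦iterate¬⟧ 𝔸 χ (suc m) v = ⟦iterate¬⟧ 𝔸 (¬' χ) m v

iterate¬-∧-idem-valid : ∀ χ m → (_≡ iterate ¬'_ (χ ∧' χ) m) ⊢≤DN iterate ¬'_ χ m
iterate¬-∧-idem-valid χ m 𝔸 F _ v premise∈F = subst F ⟦premise⟧≡⟦conclusion⟧ (premise∈F _ refl)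
  where
  open DNAlgebra 𝔸 using () renaming (_∧_ to _∧ᴬ_; ¬_ to ¬ᴬ_)
  open ≡-Reasoning
  open LatticeProperties (DNAlgebra-lattice 𝔸) using () renaming (∧-idem to ∧-idemᴬ)
  ⟦premise⟧≡⟦conclusion⟧ : ⟦ 𝔸 ⟧ (iterate ¬'_ (χ ∧' χ) m) v ≡ ⟦ 𝔸 ⟧ (iterate ¬'_ χ m) v
  ⟦premise⟧≡⟦conclusion⟧ = begin
    ⟦ 𝔸 ⟧ (iterate ¬'_ (χ ∧' χ) m) v        ≡⟨ ⟦iterate¬⟧ 𝔸 (χ ∧' χ) m v ⟩
    iterate ¬ᴬ_ (⟦ 𝔸 ⟧ χ v ∧ᴬ ⟦ 𝔸 ⟧ χ v) m  ≡⟨ cong (λ x → iterate ¬ᴬ_ x m) (∧-idemᴬ _) ⟩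
    iterate ¬ᴬ_ (⟦ 𝔸 ⟧ χ v) m               ≡⟨ ⟦iterate¬⟧ 𝔸 χ m v ⟨
    ⟦ 𝔸 ⟧ (iterate ¬'_ χ m) v               ∎

flipAt : ℕ → ℕ → Bool → Bool
flipAt k i b = if does (i ≟ k) then not b else b

flipAt-≡ : ∀ {k i} b → i ≡ k → flipAt k i b ≡ not b
flipAt-≡ {k} {i} b i≡k rewrite dec-true (i ≟ k) i≡k = refl

flipAt-< : ∀ {k i} b → i < k → flipAt k i b ≡ b
flipAt-< {k} {i} b i<k rewrite dec-false (i ≟ k) (<⇒≢ i<k) = refl

iterate-not-not : ∀ m b → iterate not (not b) m ≡ not (iterate not b m)
iterate-not-not zero b = refl
iterate-not-not (suc m) b = iterate-not-not m (not b)

iterate-not-surjective : ∀ m c → ∃ λ b → iterate not b m ≡ c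
iterate-not-surjective zero c = c , refl
iterate-not-surjective (suc m) c with b , b↦c ← iterate-not-surjective m c =
  not b , trans (cong (λ x → iterate not x m) (not-involutive b)) b↦c

¬-depth : Fm → ℕ
¬-depth (var _) = 0
¬-depth (φ ∧' ψ) = ¬-depth φ ⊔ ¬-depth ψ
¬-depth (φ ∨' ψ) = ¬-depth φ ⊔ ¬-depth ψ
¬-depth (¬' φ) = suc (¬-depth φ)
¬-depth ⊥' = 0
¬-depth ⊤' = 0

-- Not a 𝔻ℕ-algebra (∧ is not idempotent at entry k), but evaluation still commutes with substitution.
module Twisted (k : ℕ) where

  ⟪_⟫ : Fm → (ℕ → ℕ → Bool) → ℕ → Bool
  ⟪ var n ⟫ v i = v n i
  ⟪ φ ∧' ψ ⟫ v i = flipAt k i (⟪ φ ⟫ v i ∧ ⟪ ψ ⟫ v i)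
  ⟪ φ ∨' ψ ⟫ v i = ⟪ φ ⟫ v i ∨ ⟪ ψ ⟫ v i
  ⟪ ¬' φ ⟫ v i = not (⟪ φ ⟫ v (suc i))
  ⟪ ⊥' ⟫ v i = false
  ⟪ ⊤' ⟫ v i = true

  ⟪⟫-subst : ∀ ψ σ v i → ⟪ ψ [ σ ] ⟫ v i ≡ ⟪ ψ ⟫ (λ n → ⟪ σ n ⟫ v) i
  ⟪⟫-subst (var n) σ v i = refl
  ⟪⟫-subst (φ ∧' ψ) σ v i = cong (flipAt k i) (cong₂ _∧_ (⟪⟫-subst φ σ v i) (⟪⟫-subst ψ σ v i))
  ⟪⟫-subst (φ ∨' ψ) σ v i = cong₂ _∨_ (⟪⟫-subst φ σ v i) (⟪⟫-subst ψ σ v i)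
  ⟪⟫-subst (¬' φ) σ v i = cong not (⟪⟫-subst φ σ v (suc i))
  ⟪⟫-subst ⊥' σ v i = refl
  ⟪⟫-subst ⊤' σ v i = refl

  ⟪iterate¬⟫ : ∀ χ m v i → ⟪ iterate ¬'_ χ m ⟫ v i ≡ iterate not (⟪ χ ⟫ v (m + i)) m
  ⟪iterate¬⟫ χ zero v i = refl
  ⟪iterate¬⟫ χ (suc m) v i = ⟪iterate¬⟫ (¬' χ) m v i

  Holds : (ℕ → ℕ → Bool) → Fm → Set
  Holds v φ = ⟪ φ ⟫ v 0 ≡ true

  ⟪iterate¬-∧-self⟫ : ∀ χ v → ⟪ iterate ¬'_ (χ ∧' χ) k ⟫ v 0 ≡ not (⟪ iterate ¬'_ χ k ⟫ v 0)
  ⟪iterate¬-∧-self⟫ χ v = begin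
    ⟪ iterate ¬'_ (χ ∧' χ) k ⟫ v 0            ≡⟨ ⟪iterate¬⟫ (χ ∧' χ) k v 0 ⟩
    iterate not (flipAt k (k + 0) (c ∧ c)) k  ≡⟨ cong (λ x → iterate not x k) (flipAt-≡ (c ∧ c) (+-identityʳ k)) ⟩
    iterate not (not (c ∧ c)) k               ≡⟨ cong (λ x → iterate not (not x) k) (∧-idem c) ⟩
    iterate not (not c) k                     ≡⟨ iterate-not-not k c ⟩
    not (iterate not c k)                     ≡⟨ cong not (⟪iterate¬⟫ χ k v 0) ⟨
    not (⟪ iterate ¬'_ χ k ⟫ v 0)             ∎
    where
    open ≡-Reasoning
    c : Bool
    c = ⟪ χ ⟫ v (k + 0)

module _ {n : ℕ} (u : ℕ → ℕ → Bool) where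
  open Twisted n
  open ≡-Reasoning

  private
    <-+ʳ : ∀ i a → i + a < n → i < n
    <-+ʳ i a = m+n≤o⇒m≤o (suc i)

    <-⊔ˡ : ∀ i a b → i + (a ⊔ b) < n → i + a < n
    <-⊔ˡ i a b = ≤-<-trans (+-monoʳ-≤ i (m≤m⊔n a b))

    <-⊔ʳ : ∀ i a b → i + (a ⊔ b) < n → i + b < n
    <-⊔ʳ i a b = ≤-<-trans (+-monoʳ-≤ i (m≤n⊔m a b))

  private
    ⟦_⟧ₙ : Fm → Vec Bool n
    ⟦ χ ⟧ₙ = ⟦ ShiftAlgebra n ⟧ χ (λ m → prefix n (u m))

  ShiftAlgebra-agrees : ∀ ψ i → i + ¬-depth ψ < n → ⟦ ShiftAlgebra n ⟧ ψ (λ m → prefix n (u m)) ! i ≡ ⟪ ψ ⟫ u i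
  ShiftAlgebra-agrees (var m) i fits = !-prefix (u m) (<-+ʳ i 0 fits)
  ShiftAlgebra-agrees (φ ∧' ψ) i fits = begin
    zipWith _∧_ ⟦ φ ⟧ₙ ⟦ ψ ⟧ₙ ! i  ≡⟨ !-zipWith refl ⟦ φ ⟧ₙ ⟦ ψ ⟧ₙ i ⟩
    ⟦ φ ⟧ₙ ! i ∧ ⟦ ψ ⟧ₙ ! i        ≡⟨ cong₂ _∧_ (ShiftAlgebra-agrees φ i (<-⊔ˡ i _ _ fits))
                                                (ShiftAlgebra-agrees ψ i (<-⊔ʳ i _ _ fits)) ⟩
    ⟪ φ ⟫ u i ∧ ⟪ ψ ⟫ u i          ≡⟨ flipAt-< _ (<-+ʳ i _ fits) ⟨
    ⟪ φ ∧' ψ ⟫ u i                 ∎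
  ShiftAlgebra-agrees (φ ∨' ψ) i fits = begin
    zipWith _∨_ ⟦ φ ⟧ₙ ⟦ ψ ⟧ₙ ! i  ≡⟨ !-zipWith refl ⟦ φ ⟧ₙ ⟦ ψ ⟧ₙ i ⟩
    ⟦ φ ⟧ₙ ! i ∨ ⟦ ψ ⟧ₙ ! i        ≡⟨ cong₂ _∨_ (ShiftAlgebra-agrees φ i (<-⊔ˡ i _ _ fits))
                                                (ShiftAlgebra-agrees ψ i (<-⊔ʳ i _ _ fits)) ⟩
    ⟪ φ ∨' ψ ⟫ u i                 ∎
  ShiftAlgebra-agrees (¬' φ) i fits = begin
    shiftNot ⟦ φ ⟧ₙ ! i            ≡⟨ !-shiftNot ⟦ φ ⟧ₙ (<-+ʳ i _ fits) ⟩
    not (⟦ φ ⟧ₙ ! suc i)           ≡⟨ cong not (ShiftAlgebra-agrees φ (suc i) (subst (_< n) (+-suc i _) fits)) ⟩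
    ⟪ ¬' φ ⟫ u i                   ∎
  ShiftAlgebra-agrees ⊥' i fits = !-replicate false (<-+ʳ i 0 fits)
  ShiftAlgebra-agrees ⊤' i fits = !-replicate true (<-+ʳ i 0 fits)

[]-var : ∀ φ → φ [ var ] ≡ φ
[]-var (var n) = refl
[]-var (φ ∧' ψ) = cong₂ _∧'_ ([]-var φ) ([]-var ψ)
[]-var (φ ∨' ψ) = cong₂ _∨'_ ([]-var φ) ([]-var ψ)
[]-var (¬' φ) = cong ¬'_ ([]-var φ)
[]-var ⊥' = refl
[]-var ⊤' = refl

ValidRule : Rule → Set₁
ValidRule r = (_∈ premises r) ⊢≤DN conclusion r

axiomatized-rule-valid : ∀ {ℛ r} → Axiomatizes ℛ → r ∈ ℛ → ValidRule r
axiomatized-rule-valid {r = r} ax r∈ℛ = subst ValidConclusion ([]-var (conclusion r))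
  (proj₁ (ax _ _) (apply r∈ℛ var λ ψ ψ∈ → assumption (subst (_∈ premises r) (sym ([]-var ψ)) ψ∈)))
  where
  ValidConclusion : Fm → Set₁
  ValidConclusion φ = (_∈ premises r) ⊢≤DN φ

formulas : Rule → List Fm
formulas r = conclusion r ∷ premises r

depthBound : List Rule → ℕ
depthBound ℛ = max 0 (map ¬-depth (concatMap formulas ℛ))

depthBound-bounds : ∀ {ℛ r} → r ∈ ℛ → All (λ ψ → ¬-depth ψ ≤ depthBound ℛ) (formulas r)
depthBound-bounds {ℛ} = All.lookup (map⁻ (concat⁻ (map⁻ (xs≤max 0 (map ¬-depth (concatMap formulas ℛ))))))

module _ {d : ℕ} where
  open Twisted (suc d)

  valid-rule-preserves-Holds : ∀ {r} → ValidRule r → All (λ ψ → ¬-depth ψ ≤ d) (formulas r) →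
                               ∀ σ v → (∀ {ψ} → ψ ∈ premises r → Holds v (ψ [ σ ])) → Holds v (conclusion r [ σ ])
  valid-rule-preserves-Holds {r} valid (conclusion≤ ∷ premises≤) σ v premises-hold = begin
    ⟪ conclusion r [ σ ] ⟫ v 0                     ≡⟨ ⟪⟫-subst (conclusion r) σ v 0 ⟩
    ⟪ conclusion r ⟫ u 0                           ≡⟨ ShiftAlgebra-agrees u (conclusion r) 0 (s≤s conclusion≤) ⟨
    ⟦ ShiftAlgebra (suc d) ⟧ (conclusion r) w ! 0  ≡⟨ valid (ShiftAlgebra (suc d)) HeadTrue (headTrue-isFilter d) w premises-head ⟩
    true                                           ∎
    where
    open ≡-Reasoning
    u : ℕ → ℕ → Bool
    u n = ⟪ σ n ⟫ v
    w : ℕ → Vec Bool (suc d)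
    w n = prefix (suc d) (u n)
    premises-head : ∀ ψ → ψ ∈ premises r → HeadTrue (⟦ ShiftAlgebra (suc d) ⟧ ψ w)
    premises-head ψ ψ∈ = begin
      ⟦ ShiftAlgebra (suc d) ⟧ ψ w ! 0  ≡⟨ ShiftAlgebra-agrees u ψ 0 (s≤s (All.lookup premises≤ ψ∈)) ⟩
      ⟪ ψ ⟫ u 0                         ≡⟨ ⟪⟫-subst ψ σ v 0 ⟨
      ⟪ ψ [ σ ] ⟫ v 0                   ≡⟨ premises-hold ψ∈ ⟩
      true                              ∎

  derivation-preserves-Holds : ∀ {ℛ} → (∀ {r} → r ∈ ℛ → ValidRule r) →
                               (∀ {r} → r ∈ ℛ → All (λ ψ → ¬-depth ψ ≤ d) (formulas r)) →
                               ∀ {Γ φ} v → (∀ {γ} → Γ γ → Holds v γ) → Γ ⊢[ ℛ ] φ → Holds v φ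
  derivation-preserves-Holds valid shallow v Γ-holds (assumption γ) = Γ-holds γ
  derivation-preserves-Holds valid shallow v Γ-holds (apply r∈ℛ σ premises⊢) =
    valid-rule-preserves-Holds (valid r∈ℛ) (shallow r∈ℛ) σ v
      (λ ψ∈ → derivation-preserves-Holds valid shallow v Γ-holds (premises⊢ _ ψ∈))

theorem3p8 : ¬ FinitelyBased
theorem3p8 (ℛ , ax) = not-¬ conclusion-false conclusion-holds
  where
  k : ℕ
  k = suc (depthBound ℛ)
  open Twisted k
  p : Fm
  p = var 0
  b : Bool
  b = proj₁ (iterate-not-surjective k false)
  v : ℕ → ℕ → Bool
  v _ _ = b
  conclusion-false : ⟪ iterate ¬'_ p k ⟫ v 0 ≡ false
  conclusion-false = trans (⟪iterate¬⟫ p k v 0) (proj₂ (iterate-not-surjective k false))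
  premise-holds : ∀ {γ} → γ ≡ iterate ¬'_ (p ∧' p) k → Holds v γ
  premise-holds refl = trans (⟪iterate¬-∧-self⟫ p v) (cong not conclusion-false)
  derivable : (_≡ iterate ¬'_ (p ∧' p) k) ⊢[ ℛ ] iterate ¬'_ p k
  derivable = proj₂ (ax _ _) (iterate¬-∧-idem-valid p k)
  conclusion-holds : Holds v (iterate ¬'_ p k)
  conclusion-holds = derivation-preserves-Holds (axiomatized-rule-valid ax) depthBound-bounds v premise-holds derivable
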